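{- Let $Q$ be a key with vertices $\{k,k'\}$. Then there is no directed path of length greater than $1$ from $k$ to $k'$ or from $k'$ to $k$, and $Q$ is an acyclic quiver. Additionally, if $P$ is a full subquiver of $Q$, then $P$ is either abundant acyclic or itself a key.
   Context: A quiver is a finite directed multigraph with no loops and no 2-cycles; $q_{ij}$ is the number of arrows $i\to j$ if positive and minus the number of arrows $j\to i$ otherwise. A full subquiver is induced on a vertex subset; $Q\setminus V$ denotes the full subquiver on $Q_0\setminus V$. Abundant: at least two arrows between every pair of distinct vertices; acyclic: no directed cycle. A key with vertices $\{k,k'\}$ ($k\ne k'$) is a quiver $Q$ such that $Q\setminus\{k\}$ and $Q\setminus\{k'\}$ are abundant acyclic quivers, and for every vertex $i\notin\{k,k'\}$ either ($k\to i$ and $k'\to i$) or ($i\to k$ and $i\to k'$); there may be any number of arrows (including zero) between $k$ and $k'$. -}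

module Defs where

open import Data.Nat using (ℕ; zero; suc; _≤_)
open import Data.Fin using (Fin; punchIn)
open import Data.Integer using (ℤ; +_; -_; _<_; ∣_∣)
open import Data.Product using (Σ; _×_; ∃₂)
open import Data.Sum using (_⊎_)
open import Data.Empty using (⊥)
open import Relation.Nullary using (¬_)
open import Relation.Binary.PropositionalEquality using (_≡_; _≢_)

-- A quiver on vertex set Fin n, encoded by its skew-symmetric exchange matrix:
-- q i j = number of arrows i → j if positive, minus number of arrows j → i otherwise.
-- Skew-symmetry forces q i i ≡ 0 (no loops); the encoding excludes 2-cycles.
record Quiver (n : ℕ) : Set where
  field
    q    : Fin n → Fin n → ℤ
    skew : ∀ i j → q j i ≡ - q i j
open Quiver public

Arrow : ∀ {n} → Quiver n → Fin n → Fin n → Set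
Arrow Q i j = + 0 < q Q i j

data Path {n} (Q : Quiver n) : Fin n → Fin n → ℕ → Set where
  []  : ∀ {i} → Path Q i i 0
  _∷_ : ∀ {i j k L} → Arrow Q i j → Path Q j k L → Path Q i k (suc L)

Acyclic : ∀ {n} → Quiver n → Set
Acyclic Q = ∀ v L → ¬ Path Q v v (suc L)

Abundant : ∀ {n} → Quiver n → Set
Abundant Q = ∀ i j → i ≢ j → 2 ≤ ∣ q Q i j ∣

AbundantAcyclic : ∀ {n} → Quiver n → Set
AbundantAcyclic Q = Abundant Q × Acyclic Q

-- full subquiver induced along a map of vertex sets (an injection in use)
restrict : ∀ {m n} → Quiver n → (Fin m → Fin n) → Quiver m
restrict Q f = record { q = λ i j → q Q (f i) (f j) ; skew = λ i j → skew Q (f i) (f j) }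

delete : ∀ {n} → Quiver (suc n) → Fin (suc n) → Quiver n
delete Q k = restrict Q (punchIn k)

IsKey : ∀ {n} → Quiver (suc n) → Fin (suc n) → Fin (suc n) → Set
IsKey {n} Q k k' =
  (k ≢ k')
  × AbundantAcyclic (delete Q k)
  × AbundantAcyclic (delete Q k')
  × (∀ (i : Fin (suc n)) → i ≢ k → i ≢ k' →
       (Arrow Q k i × Arrow Q k' i) ⊎ (Arrow Q i k × Arrow Q i k'))

IsAKey : ∀ {n} → Quiver n → Set
IsAKey {zero}  Q = ⊥
IsAKey {suc n} Q = ∃₂ (IsKey Q)

{-# OPTIONS --safe #-}
-- Every vertex other than k, k' is either a common out-neighbour or a common
-- in-neighbour of the key vertices.  Common out-neighbours are closed under
-- successors and common in-neighbours under predecessors: an arrow from the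
-- first class to the second would close a 3-cycle through k avoiding k'.  So
-- a cycle through a non-key vertex stays in one class and avoids k, which is
-- impossible in Q ∖ {k}; and a path between key vertices only visits key
-- vertices, hence alternates k, k', k, ... and its first two arrows form a
-- 2-cycle.  A full subquiver missing k or k' lies inside the abundant acyclic
-- Q ∖ {k} or Q ∖ {k'}; one containing both is again a key.
module Submission where

open import Defs
open import Data.Nat using (suc; _≤_)
open import Data.Fin using (Fin; punchIn; punchOut; _≟_)
open import Data.Fin.Properties using (punchIn-punchOut; punchInᵢ≢i; punchIn-injective; any?)
open import Data.Integer using (+_; _<_; ∣_∣)
open import Data.Integer.Properties using (<-asym; neg-mono-<)
open import Data.Product using (_×_; _,_; ∃₂; proj₁; proj₂)
open import Data.Sum using (_⊎_; inj₁; inj₂)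
open import Data.Empty using (⊥-elim)
open import Function using (_∘_)
open import Function.Definitions using (Injective)
open import Relation.Nullary using (¬_; yes; no)
open import Relation.Binary.PropositionalEquality
  using (_≡_; _≢_; refl; sym; trans; subst; subst₂; cong; cong₂)

data AllVertices {n} (Q : Quiver n) (P : Fin n → Set) : ∀ {u v L} → Path Q u v L → Set where
  []  : ∀ {i} → P i → AllVertices Q P ([] {i = i})
  _∷_ : ∀ {i j k L} {e : Arrow Q i j} {p : Path Q j k L} →
        P i → AllVertices Q P p → AllVertices Q P (e ∷ p)

module QuiverProperties {n} (Q : Quiver n) where

  Arrow-asym : ∀ {a b} → Arrow Q a b → ¬ Arrow Q b a
  Arrow-asym {a} {b} ab ba =
    <-asym ba (subst (λ z → z < + 0) (sym (skew Q a b)) (neg-mono-< ab))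

  Arrow-irrefl : ∀ {a} → ¬ Arrow Q a a
  Arrow-irrefl aa = Arrow-asym aa aa

  Arrow⇒≢ : ∀ {a b} → Arrow Q a b → a ≢ b
  Arrow⇒≢ ab refl = Arrow-irrefl ab

  module _ {P : Fin n → Set} where

    AllVertices-head : ∀ {u v L} {p : Path Q u v L} → AllVertices Q P p → P u
    AllVertices-head ([] pu) = pu
    AllVertices-head (pu ∷ _) = pu

    AllVertices-last : ∀ {u v L} {p : Path Q u v L} → AllVertices Q P p → P v
    AllVertices-last ([] pv) = pv
    AllVertices-last (_ ∷ ps) = AllVertices-last ps

    AllVertices-map : ∀ {R : Fin n → Set} → (∀ {x} → P x → R x) →
                      ∀ {u v L} {p : Path Q u v L} → AllVertices Q P p → AllVertices Q R p
    AllVertices-map g ([] px) = [] (g px)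
    AllVertices-map g (px ∷ ps) = g px ∷ AllVertices-map g ps

    AllVertices-forward : (∀ {a b} → P a → Arrow Q a b → P b) →
                          ∀ {u v L} → P u → (p : Path Q u v L) → AllVertices Q P p
    AllVertices-forward closed pu [] = [] pu
    AllVertices-forward closed pu (e ∷ p) = pu ∷ AllVertices-forward closed (closed pu e) p

    AllVertices-backward : (∀ {a b} → P b → Arrow Q a b → P a) →
                           ∀ {u v L} → P v → (p : Path Q u v L) → AllVertices Q P p
    AllVertices-backward closed pv [] = [] pv
    AllVertices-backward closed pv (e ∷ p) =
      closed (AllVertices-head ps) e ∷ ps
      where ps = AllVertices-backward closed pv p

  Path-restrict : ∀ {m} (f : Fin m → Fin n) {u v L} → Path (restrict Q f) u v L → Path Q (f u) (f v) L
  Path-restrict f [] = []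
  Path-restrict f (e ∷ p) = e ∷ Path-restrict f p

  Acyclic-restrict : ∀ {m} (f : Fin m → Fin n) → Acyclic Q → Acyclic (restrict Q f)
  Acyclic-restrict f acyclic v L p = acyclic (f v) L (Path-restrict f p)

module DeleteProperties {n} (Q : Quiver (suc n)) (c : Fin (suc n)) where

  Path-delete : ∀ {u v L} (p : Path Q u v L) → AllVertices Q (_≢ c) p →
                ∃₂ λ u' v' → punchIn c u' ≡ u × punchIn c v' ≡ v × Path (delete Q c) u' v' L
  Path-delete [] ([] u≢c) =
    punchOut (u≢c ∘ sym) , punchOut (u≢c ∘ sym) ,
    punchIn-punchOut (u≢c ∘ sym) , punchIn-punchOut (u≢c ∘ sym) , []
  Path-delete (e ∷ p) (u≢c ∷ ps) with Path-delete p ps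
  ... | j' , v' , j'↦j , v'↦v , p' =
    punchOut (u≢c ∘ sym) , v' , punchIn-punchOut (u≢c ∘ sym) , v'↦v ,
    subst₂ (Arrow Q) (sym (punchIn-punchOut (u≢c ∘ sym))) (sym j'↦j) e ∷ p'

  cycle-avoiding : Acyclic (delete Q c) →
                   ∀ {v L} (p : Path Q v v (suc L)) → ¬ AllVertices Q (_≢ c) p
  cycle-avoiding acyclic p avoids with Path-delete p avoids
  ... | u' , v' , u'↦v , v'↦v , p' =
    acyclic v' _ (subst (λ x → Path (delete Q c) x v' _)
                        (punchIn-injective c u' v' (trans u'↦v (sym v'↦v))) p')

  Abundant-restrict-avoiding : Abundant (delete Q c) →
    ∀ {m} {f : Fin m → Fin (suc n)} → Injective _≡_ _≡_ f → (∀ i → f i ≢ c) →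
    Abundant (restrict Q f)
  Abundant-restrict-avoiding abundant {f = f} injective avoids i j i≢j =
    subst (λ z → 2 ≤ ∣ z ∣) (cong₂ (q Q) (back i) (back j))
          (abundant (out i) (out j) (i≢j ∘ injective ∘ out-injective))
    where
      out : ∀ i → Fin n
      out i = punchOut (avoids i ∘ sym)
      back : ∀ i → punchIn c (out i) ≡ f i
      back i = punchIn-punchOut (avoids i ∘ sym)
      out-injective : out i ≡ out j → f i ≡ f j
      out-injective e = trans (sym (back i)) (trans (cong (punchIn c) e) (back j))

  AbundantAcyclic-restrict-avoiding : Acyclic Q → Abundant (delete Q c) →
    ∀ {m} {f : Fin m → Fin (suc n)} → Injective _≡_ _≡_ f → (∀ i → f i ≢ c) →
    AbundantAcyclic (restrict Q f)
  AbundantAcyclic-restrict-avoiding acyclic abundant {f = f} injective avoids =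
    Abundant-restrict-avoiding abundant injective avoids ,
    QuiverProperties.Acyclic-restrict Q f acyclic

IsKey-restrict : ∀ {n m} {Q : Quiver (suc n)} {f : Fin (suc m) → Fin (suc n)} {a b} →
                 Acyclic Q → Injective _≡_ _≡_ f → IsKey Q (f a) (f b) → IsKey (restrict Q f) a b
IsKey-restrict {Q = Q} {f} {a} {b} acyclic injective (fa≢fb , (abundant-a , _) , (abundant-b , _) , common) =
  fa≢fb ∘ cong f ,
  without a abundant-a ,
  without b abundant-b ,
  λ i i≢a i≢b → common (f i) (i≢a ∘ injective) (i≢b ∘ injective)
  where
    without : ∀ x → Abundant (delete Q (f x)) → AbundantAcyclic (delete (restrict Q f) x)
    without x abundant =
      DeleteProperties.AbundantAcyclic-restrict-avoiding Q (f x) acyclic abundant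
        (punchIn-injective x _ _ ∘ injective) (λ i → punchInᵢ≢i x i ∘ injective)

module Key {n} (Q : Quiver (suc n)) (k k' : Fin (suc n)) (key : IsKey Q k k') where
  open QuiverProperties Q

  k≢k' : k ≢ k'
  k≢k' = proj₁ key

  abundantAcyclic-k : AbundantAcyclic (delete Q k)
  abundantAcyclic-k = proj₁ (proj₂ key)

  abundantAcyclic-k' : AbundantAcyclic (delete Q k')
  abundantAcyclic-k' = proj₁ (proj₂ (proj₂ key))

  IsEnd CommonOut CommonIn : Fin (suc n) → Set
  IsEnd i = i ≡ k ⊎ i ≡ k'
  CommonOut i = Arrow Q k i × Arrow Q k' i
  CommonIn i = Arrow Q i k × Arrow Q i k'

  data Position (i : Fin (suc n)) : Set where
    end        : IsEnd i → Position i
    common-out : CommonOut i → Position i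
    common-in  : CommonIn i → Position i

  position : ∀ i → Position i
  position i with i ≟ k | i ≟ k'
  ... | yes i≡k | _ = end (inj₁ i≡k)
  ... | no _ | yes i≡k' = end (inj₂ i≡k')
  ... | no i≢k | no i≢k' with proj₂ (proj₂ (proj₂ key)) i i≢k i≢k'
  ... | inj₁ out = common-out out
  ... | inj₂ in′ = common-in in′

  CommonOut⇒¬IsEnd : ∀ {i} → CommonOut i → ¬ IsEnd i
  CommonOut⇒¬IsEnd (ki , _) (inj₁ refl) = Arrow-irrefl ki
  CommonOut⇒¬IsEnd (_ , k'i) (inj₂ refl) = Arrow-irrefl k'i

  CommonIn⇒¬IsEnd : ∀ {i} → CommonIn i → ¬ IsEnd i
  CommonIn⇒¬IsEnd (ik , _) (inj₁ refl) = Arrow-irrefl ik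
  CommonIn⇒¬IsEnd (_ , ik') (inj₂ refl) = Arrow-irrefl ik'

  CommonOut-forward : ∀ {a b} → CommonOut a → Arrow Q a b → CommonOut b
  CommonOut-forward {a} {b} (ka , k'a) ab with position b
  ... | end (inj₁ refl) = ⊥-elim (Arrow-asym ka ab)
  ... | end (inj₂ refl) = ⊥-elim (Arrow-asym k'a ab)
  ... | common-out out = out
  ... | common-in (bk , bk') =
    ⊥-elim (DeleteProperties.cycle-avoiding Q k' (proj₂ abundantAcyclic-k')
              (ka ∷ (ab ∷ (bk ∷ [])))
              (k≢k' ∷ ((Arrow⇒≢ k'a ∘ sym) ∷ (Arrow⇒≢ bk' ∷ [] k≢k'))))

  CommonIn-backward : ∀ {a b} → CommonIn b → Arrow Q a b → CommonIn a
  CommonIn-backward {a} {b} (bk , bk') ab with position a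
  ... | end (inj₁ refl) = ⊥-elim (Arrow-asym ab bk)
  ... | end (inj₂ refl) = ⊥-elim (Arrow-asym ab bk')
  ... | common-out out = ⊥-elim (Arrow-asym (proj₁ (CommonOut-forward out ab)) bk)
  ... | common-in in′ = in′

  IsEnd-step : ∀ {a b c L} → IsEnd a → Arrow Q a b → Path Q b c L → IsEnd c → IsEnd b
  IsEnd-step {b = b} end-a ab p end-c with position b
  ... | end end-b = end-b
  ... | common-out out =
    ⊥-elim (CommonOut⇒¬IsEnd (AllVertices-last (AllVertices-forward CommonOut-forward out p)) end-c)
  ... | common-in in′ = ⊥-elim (CommonIn⇒¬IsEnd (CommonIn-backward in′ ab) end-a)

  IsEnd-third : ∀ {u v w} → IsEnd u → IsEnd v → IsEnd w → u ≢ v → v ≢ w → w ≡ u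
  IsEnd-third (inj₁ refl) (inj₁ refl) _ u≢v _ = ⊥-elim (u≢v refl)
  IsEnd-third (inj₂ refl) (inj₂ refl) _ u≢v _ = ⊥-elim (u≢v refl)
  IsEnd-third _ (inj₁ refl) (inj₁ refl) _ v≢w = ⊥-elim (v≢w refl)
  IsEnd-third _ (inj₂ refl) (inj₂ refl) _ v≢w = ⊥-elim (v≢w refl)
  IsEnd-third (inj₁ refl) (inj₂ refl) (inj₁ refl) _ _ = refl
  IsEnd-third (inj₂ refl) (inj₁ refl) (inj₂ refl) _ _ = refl

  no-cycle-through-end : ∀ {v L} → IsEnd v → ¬ Path Q v v (suc L)
  no-cycle-through-end end-v (vv ∷ []) = Arrow-irrefl vv
  no-cycle-through-end end-v (vw ∷ (wx ∷ p)) =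
    Arrow-asym vw (subst (Arrow Q _) (IsEnd-third end-v end-w end-x (Arrow⇒≢ vw) (Arrow⇒≢ wx)) wx)
    where
      end-w = IsEnd-step end-v vw (wx ∷ p) end-v
      end-x = IsEnd-step end-w wx p end-v

  acyclic : Acyclic Q
  acyclic v L p with position v
  ... | end end-v = no-cycle-through-end end-v p
  ... | common-out out =
    DeleteProperties.cycle-avoiding Q k (proj₂ abundantAcyclic-k) p
      (AllVertices-map (λ o → CommonOut⇒¬IsEnd o ∘ inj₁) (AllVertices-forward CommonOut-forward out p))
  ... | common-in in′ =
    DeleteProperties.cycle-avoiding Q k (proj₂ abundantAcyclic-k) p
      (AllVertices-map (λ i → CommonIn⇒¬IsEnd i ∘ inj₁) (AllVertices-backward CommonIn-backward in′ p))

  no-long-path : ∀ {a b} → IsEnd a → IsEnd b → a ≢ b → ∀ L → ¬ Path Q a b (suc (suc L))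
  no-long-path {b = b} end-a end-b a≢b L (aw ∷ p) =
    acyclic b L (subst (λ x → Path Q x b (suc L)) w≡b p)
    where
      end-w = IsEnd-step end-a aw p end-b
      w≡b = sym (IsEnd-third end-w end-a end-b (Arrow⇒≢ aw ∘ sym) a≢b)

  restrict-dichotomy : ∀ {m} (f : Fin m → Fin (suc n)) → Injective _≡_ _≡_ f →
                       AbundantAcyclic (restrict Q f) ⊎ IsAKey (restrict Q f)
  restrict-dichotomy f injective with any? (λ i → f i ≟ k) | any? (λ i → f i ≟ k')
  ... | no ∌k | _ =
    inj₁ (DeleteProperties.AbundantAcyclic-restrict-avoiding Q k acyclic (proj₁ abundantAcyclic-k)
            injective (λ i e → ∌k (i , e)))
  ... | yes _ | no ∌k' =
    inj₁ (DeleteProperties.AbundantAcyclic-restrict-avoiding Q k' acyclic (proj₁ abundantAcyclic-k')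
            injective (λ i e → ∌k' (i , e)))
  restrict-dichotomy {suc m} f injective | yes (a , fa≡k) | yes (b , fb≡k') =
    inj₂ (a , b , IsKey-restrict acyclic injective (subst₂ (IsKey Q) (sym fa≡k) (sym fb≡k') key))

corollary4p2 : ∀ {n} (Q : Quiver (suc n)) (k k' : Fin (suc n)) → IsKey Q k k' →
    (∀ L → ¬ Path Q k k' (suc (suc L)))
    × (∀ L → ¬ Path Q k' k (suc (suc L)))
    × Acyclic Q
    × (∀ m (f : Fin m → Fin (suc n)) → Injective _≡_ _≡_ f →
         AbundantAcyclic (restrict Q f) ⊎ IsAKey (restrict Q f))
corollary4p2 Q k k' key =
  no-long-path (inj₁ refl) (inj₂ refl) k≢k' ,
  no-long-path (inj₂ refl) (inj₁ refl) (k≢k' ∘ sym) ,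
  acyclic ,
  λ m → restrict-dichotomy {m}
  where open Key Q k k' key
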